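{- Let $\mathcal{G}$ be a set of positions closed under options. If every $G\in\mathcal{G}$ has at least one of the $\Diamond$-, $\Diamond^{\le}$-, $\Diamond_L^{\ngeq}$-, or $\Diamond_R^{\ngeq}$-properties, then every $G\in\mathcal{G}$ is equal to an integer.
   Context: Positions are short (finite, loop-free) combinatorial games $G=\{G^{\mathcal L}\mid G^{\mathcal R}\}$ with finite sets of Left/Right options; $G^L$, $G^R$ denote individual options. A set is closed under options if every option of a member is a member. Relations $=,\le,<$ are the usual ones; $G\ngeq H$ means "$G<H$ or $G$ is fuzzy with $H$". "$G\in\mathbb{Z}$" means $G$ equals an integer. Integer stops: $\mathrm{LS}(G)=\mathrm{RS}(G)=$ the integer equal to $G$ if $G\in\mathbb{Z}$; otherwise $\mathrm{LS}(G)=\max_{G^L}\mathrm{RS}(G^L)$, $\mathrm{RS}(G)=\min_{G^R}\mathrm{LS}(G^R)$. Guide options: $\mathrm{gd}^L(G)=\emptyset$ if $G\in\mathbb{Z}$; if $G\notin\mathbb{Z}$ and some Left option equals $\mathrm{LS}(G)$, then $\mathrm{gd}^L(G)=\{G^L:G^L=\mathrm{LS}(G)\}$; otherwise $\mathrm{gd}^L(G)=\{G^L:\mathrm{RS}(G^L)=\mathrm{LS}(G)\}$; dually $\mathrm{gd}^R(G)=\emptyset$ if $G\in\mathbb{Z}$; if $G\notin\mathbb{Z}$ and some Right option equals $\mathrm{RS}(G)$ then $\mathrm{gd}^R(G)=\{G^R:G^R=\mathrm{RS}(G)\}$; otherwise $\mathrm{gd}^R(G)=\{G^R:\mathrm{LS}(G^R)=\mathrm{RS}(G)\}$.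 Each of the following properties holds for $G$ if $G\in\mathbb{Z}$, or otherwise if there exist $G^L\in\mathrm{gd}^L(G)$ and $G^R\in\mathrm{gd}^R(G)$ such that: ($\Diamond$) there is a position $H$ that is a Right option of $G^L$ and a Left option of $G^R$; ($\Diamond^{\le}$) there are a Right option $G^{LR}$ of $G^L$ and a Left option $G^{RL}$ of $G^R$ with $G^{LR}\le G^{RL}$; ($\Diamond_L^{\ngeq}$) there is a Right option $G^{LR}$ of $G^L$ with $G^{LR}\ngeq G^R$; ($\Diamond_R^{\ngeq}$) there is a Left option $G^{RL}$ of $G^R$ with $G^L\ngeq G^{RL}$. -}

module Defs where

open import Data.Nat using (ℕ; zero; suc)
open import Data.Fin using (Fin)
open import Data.Integer as ℤ using (ℤ; +_; -[1+_])
open import Data.Product using (Σ; Σ-syntax; _×_; _,_)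
open import Data.Sum using (_⊎_)
open import Relation.Nullary using (¬_)

-- Short game forms: a finite (Fin-indexed) family of Left options and of
-- Right options.  Well-foundedness/finiteness ("short") is built in.
data Game : Set where
  mk : (l : ℕ) → (Fin l → Game) → (r : ℕ) → (Fin r → Game) → Game

nL : Game → ℕ
nL (mk l _ _ _) = l

nR : Game → ℕ
nR (mk _ _ r _) = r

Lo : (G : Game) → Fin (nL G) → Game
Lo (mk _ A _ _) = A

Ro : (G : Game) → Fin (nR G) → Game
Ro (mk _ _ _ B) = B

infix 4 _≤G_ _≈G_ _≱G_ _≅_
_≤G_ : Game → Game → Set
mk l A r B ≤G mk l' A' r' B' =
  ((i : Fin l) → ¬ (mk l' A' r' B' ≤G A i)) ×
  ((j : Fin r') → ¬ (B' j ≤G mk l A r B))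

_≈G_ : Game → Game → Set
G ≈G H = (G ≤G H) × (H ≤G G)

_≱G_ : Game → Game → Set
G ≱G H = ¬ (H ≤G G)

-- identity of positions (as hereditarily finite pairs of sets of options):
-- same sets of Left options and same sets of Right options, recursively.
_≅_ : Game → Game → Set
mk l A r B ≅ mk l' A' r' B' =
  ((i : Fin l) → Σ[ i' ∈ Fin l' ] (A i ≅ A' i')) ×
  ((i' : Fin l') → Σ[ i ∈ Fin l ] (A i ≅ A' i')) ×
  ((j : Fin r) → Σ[ j' ∈ Fin r' ] (B j ≅ B' j')) ×
  ((j' : Fin r') → Σ[ j ∈ Fin r ] (B j ≅ B' j'))

zeroG : Game
zeroG = mk 0 (λ ()) 0 (λ ())

natG : ℕ → Game
natG zero    = zeroG
natG (suc n) = mk 1 (λ _ → natG n) 0 (λ ())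

negG : ℕ → Game   -- negG n is the game -(n+1)
negG zero    = mk 0 (λ ()) 1 (λ _ → zeroG)
negG (suc n) = mk 0 (λ ()) 1 (λ _ → negG n)

⌜_⌝ : ℤ → Game
⌜ + n ⌝     = natG n
⌜ -[1+ n ] ⌝ = negG n

IsInt : Game → Set
IsInt G = Σ[ n ∈ ℤ ] (G ≈G ⌜ n ⌝)

-- Integer stops, as (functional) relations: LS G s means LS(G) = s.
LS : Game → ℤ → Set
RS : Game → ℤ → Set
LS (mk l A r B) s =
  (mk l A r B ≈G ⌜ s ⌝) ⊎
  (¬ IsInt (mk l A r B) ×
   (Σ[ i ∈ Fin l ] RS (A i) s) ×
   ((i : Fin l) (t : ℤ) → RS (A i) t → t ℤ.≤ s))
RS (mk l A r B) s =
  (mk l A r B ≈G ⌜ s ⌝) ⊎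
  (¬ IsInt (mk l A r B) ×
   (Σ[ j ∈ Fin r ] LS (B j) s) ×
   ((j : Fin r) (t : ℤ) → LS (B j) t → s ℤ.≤ t))

-- Guide options: GdL G i means the i-th Left option of G lies in gd^L(G).
GdL : (G : Game) → Fin (nL G) → Set
GdL G i =
  ¬ IsInt G ×
  Σ[ s ∈ ℤ ] (LS G s ×
    (((Σ[ k ∈ Fin (nL G) ] (Lo G k ≈G ⌜ s ⌝)) × (Lo G i ≈G ⌜ s ⌝)) ⊎
     (¬ (Σ[ k ∈ Fin (nL G) ] (Lo G k ≈G ⌜ s ⌝)) × RS (Lo G i) s)))

GdR : (G : Game) → Fin (nR G) → Set
GdR G j =
  ¬ IsInt G ×
  Σ[ s ∈ ℤ ] (RS G s ×
    (((Σ[ k ∈ Fin (nR G) ] (Ro G k ≈G ⌜ s ⌝)) × (Ro G j ≈G ⌜ s ⌝)) ⊎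
     (¬ (Σ[ k ∈ Fin (nR G) ] (Ro G k ≈G ⌜ s ⌝)) × LS (Ro G j) s)))

Diamond : Game → Set
Diamond G = IsInt G ⊎
  Σ[ i ∈ Fin (nL G) ] Σ[ j ∈ Fin (nR G) ] (GdL G i × GdR G j ×
    Σ[ a ∈ Fin (nR (Lo G i)) ] Σ[ b ∈ Fin (nL (Ro G j)) ]
      (Ro (Lo G i) a ≅ Lo (Ro G j) b))

DiamondLe : Game → Set
DiamondLe G = IsInt G ⊎
  Σ[ i ∈ Fin (nL G) ] Σ[ j ∈ Fin (nR G) ] (GdL G i × GdR G j ×
    Σ[ a ∈ Fin (nR (Lo G i)) ] Σ[ b ∈ Fin (nL (Ro G j)) ]
      (Ro (Lo G i) a ≤G Lo (Ro G j) b))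

DiamondLngeq : Game → Set
DiamondLngeq G = IsInt G ⊎
  Σ[ i ∈ Fin (nL G) ] Σ[ j ∈ Fin (nR G) ] (GdL G i × GdR G j ×
    Σ[ a ∈ Fin (nR (Lo G i)) ] (Ro (Lo G i) a ≱G Ro G j))

DiamondRngeq : Game → Set
DiamondRngeq G = IsInt G ⊎
  Σ[ i ∈ Fin (nL G) ] Σ[ j ∈ Fin (nR G) ] (GdL G i × GdR G j ×
    Σ[ b ∈ Fin (nL (Ro G j)) ] (Lo G i ≱G Lo (Ro G j) b))

ClosedUnderOptions : (Game → Set) → Set
ClosedUnderOptions 𝒢 =
  (G : Game) → 𝒢 G →
    ((i : Fin (nL G)) → 𝒢 (Lo G i)) × ((j : Fin (nR G)) → 𝒢 (Ro G j))

-- All options of G and all options of options are integers, by induction over the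
-- option-closed set.  A guide option is then a largest Left option G^L = a and a
-- smallest Right option G^R = b, and every one of the four properties yields an
-- integer H with G^L ⧏ H ⧏ G^R (for ◇ and ◇≤ because G^LR ≤ G^RL ⧏ G^R, so
-- they reduce to ◇≱_L), whence a < H < b.  Since the Left options of G are ≤ a and
-- its Right options ≥ b, the simplicity theorem makes G equal to the simplest
-- integer strictly between a and b.

module Submission where

open import Defs
open import Data.Empty using (⊥-elim)
open import Data.Fin using (Fin; zero)
open import Data.Integer as ℤ using (ℤ; +_; -[1+_]; -≤-; -≤+; +≤+; -<-; -<+; +<+)
import Data.Integer.Properties as ℤ
open import Data.Nat as ℕ using (z≤n; s≤s)
import Data.Nat.Properties as ℕ
open import Data.Product using (Σ-syntax; _×_; _,_; proj₁; proj₂)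
open import Data.Sum using (_⊎_; inj₁; inj₂)
open import Relation.Nullary using (¬_)

≤G⇒Lo≱ : ∀ {G H} → G ≤G H → (i : Fin (nL G)) → Lo G i ≱G H
≤G⇒Lo≱ {mk _ _ _ _} {mk _ _ _ _} (Gᴸ≱H , _) = Gᴸ≱H

≤G⇒≱Ro : ∀ {G H} → G ≤G H → (j : Fin (nR H)) → G ≱G Ro H j
≤G⇒≱Ro {mk _ _ _ _} {mk _ _ _ _} (_ , G≱Hᴿ) = G≱Hᴿ

≤G-trans : ∀ {G H K} → G ≤G H → H ≤G K → G ≤G K
≤G-trans {mk _ _ _ _} {mk _ _ _ _} {mk _ _ _ _} (Gᴸ≱H , G≱Hᴿ) (Hᴸ≱K , H≱Kᴿ) =
  (λ i K≤Gᴸ → Gᴸ≱H i (≤G-trans (Hᴸ≱K , H≱Kᴿ) K≤Gᴸ)) ,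
  (λ j Kᴿ≤G → H≱Kᴿ j (≤G-trans Kᴿ≤G (Gᴸ≱H , G≱Hᴿ)))

≤G-refl : (G : Game) → G ≤G G
≤G-refl (mk _ A _ B) =
  (λ i G≤Gᴸ → ≤G⇒Lo≱ G≤Gᴸ i (≤G-refl (A i))) ,
  (λ j Gᴿ≤G → ≤G⇒≱Ro Gᴿ≤G j (≤G-refl (B j)))

Lo≱ : (G : Game) (i : Fin (nL G)) → Lo G i ≱G G
Lo≱ G i G≤Gᴸ = ≤G⇒Lo≱ G≤Gᴸ i (≤G-refl (Lo G i))

≱Ro : (G : Game) (j : Fin (nR G)) → G ≱G Ro G j
≱Ro G j Gᴿ≤G = ≤G⇒≱Ro Gᴿ≤G j (≤G-refl (Ro G j))

≤-≱-trans : ∀ {G H K} → G ≤G H → H ≱G K → G ≱G K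
≤-≱-trans G≤H H≱K K≤G = H≱K (≤G-trans K≤G G≤H)

≱-≤-trans : ∀ {G H K} → G ≱G H → H ≤G K → G ≱G K
≱-≤-trans G≱H H≤K K≤G = G≱H (≤G-trans H≤K K≤G)

≅⇒≤G : ∀ {G H} → G ≅ H → G ≤G H
≅⇒≤G {mk _ A _ _} {mk _ A' _ B'} (A⊆A' , _ , _ , B'⊆B) =
  (λ i → let (i' , Aᵢ≅A'ᵢ') = A⊆A' i in
    ≤-≱-trans (≅⇒≤G Aᵢ≅A'ᵢ') (Lo≱ _ i')) ,
  (λ j' → let (j , Bⱼ≅B'ⱼ') = B'⊆B j' in
    ≱-≤-trans (≱Ro _ j) (≅⇒≤G Bⱼ≅B'ⱼ'))

mutual
  natG-mono-≤ : ∀ {m n} → m ℕ.≤ n → natG m ≤G natG n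
  natG-mono-≤ {ℕ.zero}  {ℕ.zero}  _         = (λ ()) , (λ ())
  natG-mono-≤ {ℕ.zero}  {ℕ.suc _} _         = (λ ()) , (λ ())
  natG-mono-≤ {ℕ.suc _} {ℕ.suc _} (s≤s m≤n) = (λ _ → natG-mono-< (s≤s m≤n)) , (λ ())

  natG-mono-< : ∀ {m n} → m ℕ.< n → natG m ≱G natG n
  natG-mono-< {n = ℕ.suc _} (s≤s m≤n′) natGn≤natGm = ≤G⇒Lo≱ natGn≤natGm zero (natG-mono-≤ m≤n′)

negG≤natG : ∀ m n → negG m ≤G natG n
negG≤natG ℕ.zero    ℕ.zero    = (λ ()) , (λ ())
negG≤natG ℕ.zero    (ℕ.suc _) = (λ ()) , (λ ())
negG≤natG (ℕ.suc _) ℕ.zero    = (λ ()) , (λ ())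
negG≤natG (ℕ.suc _) (ℕ.suc _) = (λ ()) , (λ ())

negG≱natG : ∀ m n → negG m ≱G natG n
negG≱natG ℕ.zero    n natGn≤negGm = ≤G⇒≱Ro natGn≤negGm zero (natG-mono-≤ z≤n)
negG≱natG (ℕ.suc m) n natGn≤negGm = ≤G⇒≱Ro natGn≤negGm zero (negG≤natG m n)

mutual
  negG-anti-≤ : ∀ {m n} → n ℕ.≤ m → negG m ≤G negG n
  negG-anti-≤ {ℕ.zero}  {ℕ.zero}  _   = (λ ()) , (λ _ → negG≱natG 0 0)
  negG-anti-≤ {ℕ.suc m} {ℕ.zero}  _   = (λ ()) , (λ _ → negG≱natG (ℕ.suc m) 0)
  negG-anti-≤ {ℕ.suc _} {ℕ.suc _} n≤m = (λ ()) , (λ _ → negG-anti-< n≤m)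

  negG-anti-< : ∀ {m n} → n ℕ.< m → negG m ≱G negG n
  negG-anti-< {ℕ.suc _} (s≤s n≤m′) negGn≤negGm = ≤G⇒≱Ro negGn≤negGm zero (negG-anti-≤ n≤m′)

⌜⌝-mono-≤ : ∀ {m n} → m ℤ.≤ n → ⌜ m ⌝ ≤G ⌜ n ⌝
⌜⌝-mono-≤ (-≤- n≤m) = negG-anti-≤ n≤m
⌜⌝-mono-≤ -≤+       = negG≤natG _ _
⌜⌝-mono-≤ (+≤+ m≤n) = natG-mono-≤ m≤n

⌜⌝-mono-< : ∀ {m n} → m ℤ.< n → ⌜ m ⌝ ≱G ⌜ n ⌝
⌜⌝-mono-< (-<- n<m) = negG-anti-< n<m
⌜⌝-mono-< -<+       = negG≱natG _ _
⌜⌝-mono-< (+<+ m<n) = natG-mono-< m<n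

simplicity : (G X : Game) (i₀ : Fin (nL G)) (j₀ : Fin (nR G)) →
  (∀ i → Lo G i ≤G Lo G i₀) → (∀ j → Ro G j₀ ≤G Ro G j) →
  Lo G i₀ ≱G X → X ≱G Ro G j₀ →
  (∀ i → Lo X i ≤G Lo G i₀) → (∀ j → Ro G j₀ ≤G Ro X j) →
  G ≈G X
simplicity (mk _ _ _ _) (mk _ _ _ _) i₀ j₀ maxL minR Gᴸ≱X X≱Gᴿ Xᴸ≤Gᴸ Gᴿ≤Xᴿ =
  ((λ i → ≤-≱-trans (maxL i) Gᴸ≱X) ,
   (λ j → ≱-≤-trans (≱Ro _ j₀) (Gᴿ≤Xᴿ j))) ,
  ((λ i → ≤-≱-trans (Xᴸ≤Gᴸ i) (Lo≱ _ i₀)) ,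
   (λ j → ≱-≤-trans X≱Gᴿ (minR j)))

simplestIntegerBetween : ∀ {a y b} → a ℤ.< y → y ℤ.< b →
  Σ[ n ∈ ℤ ] (a ℤ.< n × n ℤ.< b ×
    (∀ i → Lo ⌜ n ⌝ i ≤G ⌜ a ⌝) × (∀ j → ⌜ b ⌝ ≤G Ro ⌜ n ⌝ j))
simplestIntegerBetween {+ m} (+<+ m<k) (+<+ k<j) =
  + ℕ.suc m , +<+ (ℕ.n<1+n m) , +<+ (ℕ.≤-<-trans m<k k<j) ,
  (λ _ → ≤G-refl (natG m)) , (λ ())
simplestIntegerBetween { -[1+ _ ]} {b = + ℕ.suc _} _ _ =
  + 0 , -<+ , +<+ (s≤s z≤n) , (λ ()) , (λ ())
simplestIntegerBetween { -[1+ _ ]} { -[1+ _ ]} {+ 0} (-<- p<n) -<+ =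
  -[1+ 0 ] , -<- (ℕ.≤-<-trans z≤n p<n) , -<+ , (λ ()) , (λ _ → ≤G-refl zeroG)
simplestIntegerBetween { -[1+ _ ]} { -[1+ _ ]} { -[1+ k ]} (-<- p<n) (-<- k<p) =
  -[1+ ℕ.suc k ] , -<- (ℕ.≤-<-trans k<p p<n) , -<- (ℕ.n<1+n k) ,
  (λ ()) , (λ _ → ≤G-refl (negG k))

IntegralOptions : Game → Set
IntegralOptions G = (∀ i → IsInt (Lo G i)) × (∀ j → IsInt (Ro G j))

≈⇒LS : ∀ {G s} → G ≈G ⌜ s ⌝ → LS G s
≈⇒LS {mk _ _ _ _} = inj₁

≈⇒RS : ∀ {G s} → G ≈G ⌜ s ⌝ → RS G s
≈⇒RS {mk _ _ _ _} = inj₁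

LS⇒≈ : ∀ {G s} → IsInt G → LS G s → G ≈G ⌜ s ⌝
LS⇒≈ {mk _ _ _ _} _   (inj₁ G≈s)        = G≈s
LS⇒≈ {mk _ _ _ _} G∈ℤ (inj₂ (G∉ℤ , _)) = ⊥-elim (G∉ℤ G∈ℤ)

RS⇒≈ : ∀ {G s} → IsInt G → RS G s → G ≈G ⌜ s ⌝
RS⇒≈ {mk _ _ _ _} _   (inj₁ G≈s)        = G≈s
RS⇒≈ {mk _ _ _ _} G∈ℤ (inj₂ (G∉ℤ , _)) = ⊥-elim (G∉ℤ G∈ℤ)

LS-upperBound : ∀ {G s} → ¬ IsInt G → LS G s →
  (∀ i → IsInt (Lo G i)) → ∀ i → Lo G i ≤G ⌜ s ⌝
LS-upperBound {mk _ _ _ _} {s} G∉ℤ (inj₁ G≈s) _ _ = ⊥-elim (G∉ℤ (s , G≈s))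
LS-upperBound {mk _ _ _ _} _ (inj₂ (_ , _ , max)) Aℤ i =
  let (t , Aᵢ≈t) = Aℤ i in
  ≤G-trans (proj₁ Aᵢ≈t) (⌜⌝-mono-≤ (max i t (≈⇒RS Aᵢ≈t)))

RS-lowerBound : ∀ {G s} → ¬ IsInt G → RS G s →
  (∀ j → IsInt (Ro G j)) → ∀ j → ⌜ s ⌝ ≤G Ro G j
RS-lowerBound {mk _ _ _ _} {s} G∉ℤ (inj₁ G≈s) _ _ = ⊥-elim (G∉ℤ (s , G≈s))
RS-lowerBound {mk _ _ _ _} _ (inj₂ (_ , _ , min)) Bℤ j =
  let (t , Bⱼ≈t) = Bℤ j in
  ≤G-trans (⌜⌝-mono-≤ (min j t (≈⇒LS Bⱼ≈t))) (proj₂ Bⱼ≈t)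

GdL⇒largest : ∀ {G i} → (∀ k → IsInt (Lo G k)) → GdL G i → ∀ k → Lo G k ≤G Lo G i
GdL⇒largest Lℤ (G∉ℤ , s , LS≡s , inj₁ (_ , Gᴸ≈s)) k =
  ≤G-trans (LS-upperBound G∉ℤ LS≡s Lℤ k) (proj₂ Gᴸ≈s)
GdL⇒largest {i = i} Lℤ (G∉ℤ , s , LS≡s , inj₂ (_ , RS≡s)) k =
  ≤G-trans (LS-upperBound G∉ℤ LS≡s Lℤ k) (proj₂ (RS⇒≈ (Lℤ i) RS≡s))

GdR⇒smallest : ∀ {G j} → (∀ k → IsInt (Ro G k)) → GdR G j → ∀ k → Ro G j ≤G Ro G k
GdR⇒smallest Rℤ (G∉ℤ , s , RS≡s , inj₁ (_ , Gᴿ≈s)) k =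
  ≤G-trans (proj₁ Gᴿ≈s) (RS-lowerBound G∉ℤ RS≡s Rℤ k)
GdR⇒smallest {j = j} Rℤ (G∉ℤ , s , RS≡s , inj₂ (_ , LS≡s)) k =
  ≤G-trans (proj₁ (LS⇒≈ (Rℤ j) LS≡s)) (RS-lowerBound G∉ℤ RS≡s Rℤ k)

≈⌜⌝-≱⇒< : ∀ {G H a b} → G ≈G ⌜ a ⌝ → H ≈G ⌜ b ⌝ → G ≱G H → a ℤ.< b
≈⌜⌝-≱⇒< (_ , a≤G) (H≤b , _) G≱H =
  ℤ.≰⇒> λ b≤a → G≱H (≤G-trans H≤b (≤G-trans (⌜⌝-mono-≤ b≤a) a≤G))

integerBetweenGuides⇒IsInt : ∀ {G i j H} → IntegralOptions G → GdL G i → GdR G j →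
  IsInt H → Lo G i ≱G H → H ≱G Ro G j → IsInt G
integerBetweenGuides⇒IsInt {G} {i} {j} (Lℤ , Rℤ) gdL gdR (y , H≈y) Gᴸ≱H H≱Gᴿ =
  let (a , Gᴸ≈a) = Lℤ i
      (b , Gᴿ≈b) = Rℤ j
      (n , a<n , n<b , nᴸ≤a , b≤nᴿ) = simplestIntegerBetween {a} {y} {b}
        (≈⌜⌝-≱⇒< Gᴸ≈a H≈y Gᴸ≱H) (≈⌜⌝-≱⇒< H≈y Gᴿ≈b H≱Gᴿ)
  in n , simplicity G ⌜ n ⌝ i j (GdL⇒largest Lℤ gdL) (GdR⇒smallest Rℤ gdR)
           (≤-≱-trans (proj₁ Gᴸ≈a) (⌜⌝-mono-< a<n))
           (≱-≤-trans (⌜⌝-mono-< n<b) (proj₂ Gᴿ≈b))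
           (λ k → ≤G-trans (nᴸ≤a k) (proj₂ Gᴸ≈a))
           (λ k → ≤G-trans (proj₁ Gᴿ≈b) (b≤nᴿ k))

Diamond⇒DiamondLe : ∀ {G} → Diamond G → DiamondLe G
Diamond⇒DiamondLe (inj₁ G∈ℤ) = inj₁ G∈ℤ
Diamond⇒DiamondLe (inj₂ (i , j , gdL , gdR , a , b , Gᴸᴿ≅Gᴿᴸ)) =
  inj₂ (i , j , gdL , gdR , a , b , ≅⇒≤G Gᴸᴿ≅Gᴿᴸ)

DiamondLe⇒DiamondLngeq : ∀ {G} → DiamondLe G → DiamondLngeq G
DiamondLe⇒DiamondLngeq (inj₁ G∈ℤ) = inj₁ G∈ℤ
DiamondLe⇒DiamondLngeq {G} (inj₂ (i , j , gdL , gdR , a , b , Gᴸᴿ≤Gᴿᴸ)) =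
  inj₂ (i , j , gdL , gdR , a , ≤-≱-trans Gᴸᴿ≤Gᴿᴸ (Lo≱ (Ro G j) b))

DiamondLngeq⇒IsInt : ∀ {G} → IntegralOptions G → (∀ i → IntegralOptions (Lo G i)) →
  DiamondLngeq G → IsInt G
DiamondLngeq⇒IsInt _ _ (inj₁ G∈ℤ) = G∈ℤ
DiamondLngeq⇒IsInt {G} Gℤ Gᴸℤ (inj₂ (i , j , gdL , gdR , a , Gᴸᴿ≱Gᴿ)) =
  integerBetweenGuides⇒IsInt Gℤ gdL gdR (proj₂ (Gᴸℤ i) a) (≱Ro (Lo G i) a) Gᴸᴿ≱Gᴿ

DiamondRngeq⇒IsInt : ∀ {G} → IntegralOptions G → (∀ j → IntegralOptions (Ro G j)) →
  DiamondRngeq G → IsInt G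
DiamondRngeq⇒IsInt _ _ (inj₁ G∈ℤ) = G∈ℤ
DiamondRngeq⇒IsInt {G} Gℤ Gᴿℤ (inj₂ (i , j , gdL , gdR , b , Gᴸ≱Gᴿᴸ)) =
  integerBetweenGuides⇒IsInt Gℤ gdL gdR (proj₁ (Gᴿℤ j) b) Gᴸ≱Gᴿᴸ (Lo≱ (Ro G j) b)

AnyDiamond : Game → Set
AnyDiamond G = Diamond G ⊎ DiamondLe G ⊎ DiamondLngeq G ⊎ DiamondRngeq G

AnyDiamond⇒IsInt : ∀ {G} → IntegralOptions G →
  (∀ i → IntegralOptions (Lo G i)) → (∀ j → IntegralOptions (Ro G j)) →
  AnyDiamond G → IsInt G
AnyDiamond⇒IsInt Gℤ Gᴸℤ _ (inj₁ ◇) =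
  DiamondLngeq⇒IsInt Gℤ Gᴸℤ (DiamondLe⇒DiamondLngeq (Diamond⇒DiamondLe ◇))
AnyDiamond⇒IsInt Gℤ Gᴸℤ _ (inj₂ (inj₁ ◇≤)) =
  DiamondLngeq⇒IsInt Gℤ Gᴸℤ (DiamondLe⇒DiamondLngeq ◇≤)
AnyDiamond⇒IsInt Gℤ Gᴸℤ _ (inj₂ (inj₂ (inj₁ ◇ᴸ))) = DiamondLngeq⇒IsInt Gℤ Gᴸℤ ◇ᴸ
AnyDiamond⇒IsInt Gℤ _ Gᴿℤ (inj₂ (inj₂ (inj₂ ◇ᴿ))) = DiamondRngeq⇒IsInt Gℤ Gᴿℤ ◇ᴿ

module _ (𝒢 : Game → Set) (closed : ClosedUnderOptions 𝒢)
         (diamonds : ∀ G → 𝒢 G → AnyDiamond G) where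

  mutual
    member⇒IsInt : ∀ G → 𝒢 G → IsInt G
    member⇒IsInt G@(mk _ A _ B) G∈𝒢 =
      let (Aᵢ∈𝒢 , Bⱼ∈𝒢) = closed G G∈𝒢 in
      AnyDiamond⇒IsInt (member⇒IntegralOptions G G∈𝒢)
        (λ i → member⇒IntegralOptions (A i) (Aᵢ∈𝒢 i))
        (λ j → member⇒IntegralOptions (B j) (Bⱼ∈𝒢 j))
        (diamonds G G∈𝒢)

    member⇒IntegralOptions : ∀ G → 𝒢 G → IntegralOptions G
    member⇒IntegralOptions G@(mk _ A _ B) G∈𝒢 =
      let (Aᵢ∈𝒢 , Bⱼ∈𝒢) = closed G G∈𝒢 in
      (λ i → member⇒IsInt (A i) (Aᵢ∈𝒢 i)) , (λ j → member⇒IsInt (B j) (Bⱼ∈𝒢 j))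

corollary3 : (𝒢 : Game → Set) → ClosedUnderOptions 𝒢 →
    ((G : Game) → 𝒢 G →
      Diamond G ⊎ DiamondLe G ⊎ DiamondLngeq G ⊎ DiamondRngeq G) →
    (G : Game) → 𝒢 G → IsInt G
corollary3 𝒢 closed diamonds = member⇒IsInt 𝒢 closed diamonds
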